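{- Let $G=(V,E)$ be a hedgegraph with connectivity $\lambda$ and weak partition connectivity $\mathrm{WPC}_G$. Then $\lfloor\lambda/2\rfloor\le\mathrm{WPC}_G$.
   Context: A hedgegraph $G=(V,E)$ consists of a finite vertex set $V$ and a finite set $E$ of hedges; each hedge is a set of hyperedges (subsets of $V$), the hyperedges within one hedge are pairwise vertex-disjoint, and no hyperedge belongs to two hedges. For $S\subseteq V$, $\delta(S)$ is the set of hedges containing a hyperedge $h$ with $h\cap S\ne\emptyset$ and $h\setminus S\ne\emptyset$; $\lambda=\min\{|\delta(S)|:\emptyset\ne S\subsetneq V\}$. For a partition $\mathcal{P}$ of $V$ into nonempty parts and a hedge $e$, $\mathcal{P}(e)$ is the hedgegraph obtained from $(V,\{e\})$ by contracting each part of $\mathcal{P}$ into a single vertex, and $\#\mathrm{Comps}(\mathcal{P}(e))$ is its number of connected components. $\mathrm{WPC}_G=\min_{\mathcal{P}}\left\lfloor\frac{\sum_{e\in E}(|\mathcal{P}|-\#\mathrm{Comps}(\mathcal{P}(e)))}{|\mathcal{P}|-1}\right\rfloor$ over partitions $\mathcal{P}$ of $V$ (with $0/0=+\infty$). -}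

module Defs where

open import Data.Nat using (ℕ; zero; suc; _+_; _∸_; _≤_; _/_)
open import Data.Bool using (Bool; true; false; _∧_; if_then_else_)
open import Data.Fin using (Fin)
open import Data.Fin.Subset using (Subset; _∈_; _∉_; _∩_; ∁; Nonempty; Empty)
open import Data.Fin.Subset.Properties using (nonempty?)
open import Data.List using (List; length; lookup; tabulate)
open import Data.Nat.ListAction using (sum)
import Data.List.Membership.Propositional as LM
open import Data.Product using (Σ; ∃; _×_; _,_)
open import Relation.Nullary using (¬_; does)
open import Relation.Binary.PropositionalEquality using (_≡_; _≢_)
open import Relation.Binary.Construct.Closure.ReflexiveTransitive using (Star)
open import Function.Bundles using (_⇔_)

data ℕ∞ : Set where
  fin : ℕ → ℕ∞
  ∞   : ℕ∞

data _≤∞_ : ℕ∞ → ℕ∞ → Set where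
  fin≤fin : ∀ {a b} → a ≤ b → fin a ≤∞ fin b
  _≤∞∞    : ∀ x → x ≤∞ ∞

half∞ : ℕ∞ → ℕ∞
half∞ (fin a) = fin (a / 2)
half∞ ∞       = ∞

-- Hedgegraphs on the vertex set V = Fin n.
-- A hyperedge is a subset of V; a hedge is a finite list of hyperedges;
-- the hedges are indexed by Fin m.

Hyperedge : ℕ → Set
Hyperedge n = Subset n

Hedge : ℕ → Set
Hedge n = List (Hyperedge n)

record Hedgegraph (n : ℕ) : Set where
  field
    m     : ℕ
    hedge : Fin m → Hedge n
    disjoint : ∀ (e : Fin m) (i j : Fin (length (hedge e))) → i ≢ j →
               Empty (lookup (hedge e) i ∩ lookup (hedge e) j)
    unique : ∀ (e e′ : Fin m) → e ≢ e′ → ∀ (h : Hyperedge n) →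
             h LM.∈ hedge e → ¬ (h LM.∈ hedge e′)

open Hedgegraph public

crosses : ∀ {n} → Subset n → Hyperedge n → Bool
crosses S h = does (nonempty? (h ∩ S)) ∧ does (nonempty? (h ∩ ∁ S))

anyB : ∀ {A : Set} → (A → Bool) → List A → Bool
anyB p List.[] = false
anyB p (x List.∷ xs) = if p x then true else anyB p xs

inδ : ∀ {n} (G : Hedgegraph n) → Subset n → Fin (m G) → Bool
inδ G S e = anyB (crosses S) (hedge G e)

cutSize : ∀ {n} (G : Hedgegraph n) → Subset n → ℕ
cutSize G S = sum (tabulate (λ e → if inδ G S e then 1 else 0))

NonemptyProper : ∀ {n} → Subset n → Set
NonemptyProper S = Nonempty S × Nonempty (∁ S)

-- λ = min over nonempty proper S of |δ(S)|  (min ∅ = +∞)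
IsConnectivity : ∀ {n} → Hedgegraph n → ℕ∞ → Set
IsConnectivity {n} G (fin l) =
  (Σ (Subset n) λ S → NonemptyProper S × cutSize G S ≡ l) ×
  (∀ (S : Subset n) → NonemptyProper S → l ≤ cutSize G S)
IsConnectivity {n} G ∞ = ∀ (S : Subset n) → ¬ NonemptyProper S

-- Partitions of V = Fin n into k nonempty parts, given by a surjective
-- labelling p : Fin n → Fin k (part j = p⁻¹(j)).

record Partition (n : ℕ) : Set where
  field
    k     : ℕ
    part  : Fin n → Fin k
    onto  : ∀ (j : Fin k) → ∃ λ v → part v ≡ j

open Partition public

-- In P(e) (contract each part of P in (V,{e})), parts u and v are joined
-- directly when some hyperedge of e meets both.
Adjacent : ∀ {n} (G : Hedgegraph n) (P : Partition n) (e : Fin (m G)) →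
           Fin (k P) → Fin (k P) → Set
Adjacent G P e u v =
  Σ _ λ h → h LM.∈ hedge G e ×
    (Σ _ λ x → Σ _ λ y → x ∈ h × y ∈ h × part P x ≡ u × part P y ≡ v)

ConnectedIn : ∀ {n} (G : Hedgegraph n) (P : Partition n) (e : Fin (m G)) →
              Fin (k P) → Fin (k P) → Set
ConnectedIn G P e = Star (Adjacent G P e)

-- #Comps(P(e)) = c : the connected components of P(e) are in bijection
-- with Fin c (f sends a vertex to its component).
NumComps : ∀ {n} (G : Hedgegraph n) (P : Partition n) (e : Fin (m G)) →
           ℕ → Set
NumComps G P e c =
  Σ (Fin (k P) → Fin c) λ f →
    (∀ (i : Fin c) → ∃ λ u → f u ≡ i) ×
    (∀ u v → (f u ≡ f v) ⇔ ConnectedIn G P e u v)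

-- ⌊ (Σ_e (|P| - #Comps(P(e)))) / (|P| - 1) ⌋ with 0/0 = +∞
-- (given the component counts cs e = #Comps(P(e)))
wpcValue : ∀ {n} (G : Hedgegraph n) (P : Partition n) → (Fin (m G) → ℕ) → ℕ∞
wpcValue G P cs with k P ∸ 1
... | zero  = ∞
... | suc d = fin (sum (tabulate (λ e → k P ∸ cs e)) / suc d)

PartitionValue : ∀ {n} (G : Hedgegraph n) (P : Partition n) → ℕ∞ → Set
PartitionValue G P w =
  Σ (Fin (m G) → ℕ) λ cs → (∀ e → NumComps G P e (cs e)) × wpcValue G P cs ≡ w

IsWPC : ∀ {n} → Hedgegraph n → ℕ∞ → Set
IsWPC G w =
  (Σ (Partition _) λ P → PartitionValue G P w) ×
  (∀ P v → PartitionValue G P v → w ≤∞ v)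

-- Let P be a partition of V into k ≥ 2 parts. Every part is a nonempty
-- proper set, so k λ ≤ Σᵢ |δ(Pᵢ)| = Σₑ #{parts crossed by e}. A part
-- crossed by e shares its component of P(e) with some other part, and a
-- component made of s ≥ 2 parts holds at most s ≤ 2(s − 1) crossed parts,
-- so e crosses at most 2(k − #Comps(P(e))) parts. Hence
-- k λ ≤ 2 Σₑ (k − #Comps(P(e))), and ⌊λ/2⌋ (k − 1) ≤ k λ / 2 bounds the
-- value of P from below.
module Submission where

open import Data.Bool using (Bool; true; false; if_then_else_)
open import Data.Fin using (Fin; zero; suc; punchIn; _≟_)
open import Data.Fin.Properties using (punchInᵢ≢i)
open import Data.Fin.Subset using (Subset; _∈_; _∩_; ∁; Nonempty)
open import Data.Fin.Subset.Properties using (nonempty?; x∈p∩q⁻; x∈∁p⇒x∉p; x∉p⇒x∈∁p)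
open import Data.List using (_∷_; tabulate)
import Data.List.Membership.Propositional as List
open import Data.List.Relation.Unary.Any using (here; there)
open import Data.Nat using (ℕ; zero; suc; _+_; _*_; _∸_; _≤_; _<_; _/_; z≤n; s≤s; z<s)
import Data.Nat.ListAction as List
open import Data.Nat.DivMod using (m/n*n≤m; m*n/n≡m; /-monoˡ-≤)
open import Data.Nat.Properties
  using ( +-*-semiring; +-identityʳ; *-identityʳ; *-zeroʳ; *-comm; *-assoc
        ; *-distribˡ-∸; +-comm; ≤-refl; ≤-trans; ≤-reflexive; m≤m+n; m≤n+m
        ; +-mono-≤; +-monoʳ-≤; *-monoˡ-≤; *-monoʳ-≤; *-cancelˡ-≤
        ; n≤1+n; m+n≤o⇒m≤o∸n; module ≤-Reasoning)
import Data.Vec as Vec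
open import Data.Vec.Properties using (lookup∘tabulate; []=⇒lookup; lookup⇒[]=)
open import Data.Product using (∃; _×_; _,_; proj₁; proj₂; map₁)
open import Function using (_∘_)
open import Function.Bundles using (Equivalence)
open import Relation.Nullary using (Dec; yes; does; contradiction)
open import Relation.Nullary.Decidable using (dec-true)
open import Relation.Binary.PropositionalEquality
  using (_≡_; _≢_; refl; sym; trans; cong; cong₂; subst; module ≡-Reasoning)
open import Relation.Binary.Construct.Closure.ReflexiveTransitive using (ε; _◅_)
open import Defs

open import Algebra.Properties.Semiring.Sum +-*-semiring
  using (sum; sum-syntax; ∑-comm; ∑-distrib-+; sum-cong-≗; *-distribˡ-sum)

𝟙 : Bool → ℕ
𝟙 b = if b then 1 else 0

kronecker : ∀ {c} → Fin c → Fin c → ℕ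
kronecker zero    zero    = 1
kronecker zero    (suc _) = 0
kronecker (suc _) zero    = 0
kronecker (suc u) (suc t) = kronecker u t

sum-tabulate : ∀ {k} (f : Fin k → ℕ) → List.sum (tabulate f) ≡ ∑[ i < k ] f i
sum-tabulate {zero}  f = refl
sum-tabulate {suc k} f = cong (f zero +_) (sum-tabulate (f ∘ suc))

∑-const : ∀ k c → ∑[ i < k ] c ≡ k * c
∑-const zero    c = refl
∑-const (suc k) c = cong (c +_) (∑-const k c)

∑-mono-≤ : ∀ {k} {f g : Fin k → ℕ} → (∀ i → f i ≤ g i) →
           ∑[ i < k ] f i ≤ ∑[ i < k ] g i
∑-mono-≤ {zero}  f≤g = z≤n
∑-mono-≤ {suc k} f≤g = +-mono-≤ (f≤g zero) (∑-mono-≤ (f≤g ∘ suc))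

term≤∑ : ∀ {k} (f : Fin k → ℕ) i → f i ≤ sum f
term≤∑ f zero    = m≤m+n _ _
term≤∑ f (suc i) = ≤-trans (term≤∑ (f ∘ suc) i) (m≤n+m _ _)

two-terms≤∑ : ∀ {k} (f : Fin k → ℕ) {i j} → i ≢ j → f i + f j ≤ sum f
two-terms≤∑ f {zero}  {zero}  i≢j = contradiction refl i≢j
two-terms≤∑ f {zero}  {suc j} i≢j = +-monoʳ-≤ (f zero) (term≤∑ (f ∘ suc) j)
two-terms≤∑ f {suc i} {zero}  i≢j = subst (_≤ sum f) (+-comm (f zero) (f (suc i)))
  (+-monoʳ-≤ (f zero) (term≤∑ (f ∘ suc) i))
two-terms≤∑ f {suc i} {suc j} i≢j =
  ≤-trans (two-terms≤∑ (f ∘ suc) (i≢j ∘ cong suc)) (m≤n+m _ _)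

∑-pos⇒pos : ∀ {k} (f : Fin k → ℕ) → 0 < sum f → ∃ λ i → 0 < f i
∑-pos⇒pos {suc k} f pos with f zero in f0≡
... | suc _ = zero , subst (0 <_) (sym f0≡) z<s
... | zero  = let i , fi>0 = ∑-pos⇒pos (f ∘ suc) pos in suc i , fi>0

∑-kronecker : ∀ {c} (u : Fin c) x → ∑[ t < c ] (kronecker u t * x) ≡ x
∑-kronecker {suc c} zero    x =
  trans (cong₂ _+_ (+-identityʳ x) (trans (∑-const c 0) (*-zeroʳ c))) (+-identityʳ x)
∑-kronecker {suc c} (suc u) x = ∑-kronecker u x

∑-fibres : ∀ {k c} (f : Fin k → Fin c) (g : Fin k → ℕ) →
           ∑[ i < k ] g i ≡ ∑[ t < c ] ∑[ i < k ] (kronecker (f i) t * g i)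
∑-fibres f g = trans (sum-cong-≗ (λ i → sym (∑-kronecker (f i) (g i))))
                     (∑-comm (λ i t → kronecker (f i) t * g i))

kronecker-refl : ∀ {c} (u : Fin c) → kronecker u u ≡ 1
kronecker-refl zero    = refl
kronecker-refl (suc u) = kronecker-refl u

kronecker*-pos : ∀ {c} (u t : Fin c) x → 0 < kronecker u t * x → u ≡ t × 0 < x
kronecker*-pos zero    zero    x pos = refl , subst (0 <_) (+-identityʳ x) pos
kronecker*-pos (suc u) (suc t) x pos = map₁ (cong suc) (kronecker*-pos u t x pos)

𝟙≤1 : ∀ b → 𝟙 b ≤ 1
𝟙≤1 true  = ≤-refl
𝟙≤1 false = z≤n

𝟙-pos : ∀ {b} → 0 < 𝟙 b → b ≡ true
𝟙-pos {true} _ = refl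

module _ {k c} (f : Fin k → Fin c) (f-onto : ∀ t → ∃ λ u → f u ≡ t)
         (marked : Fin k → Bool)
         (partner : ∀ u → marked u ≡ true → ∃ λ j → j ≢ u × f j ≡ f u) where

  private
    fibreSize : Fin c → ℕ
    fibreSize t = ∑[ i < k ] kronecker (f i) t

    markedIn : Fin c → ℕ
    markedIn t = ∑[ i < k ] (kronecker (f i) t * 𝟙 (marked i))

    markedIn≤fibreSize : ∀ t → markedIn t ≤ fibreSize t
    markedIn≤fibreSize t = ∑-mono-≤ λ i →
      ≤-trans (*-monoʳ-≤ (kronecker (f i) t) (𝟙≤1 (marked i))) (≤-reflexive (*-identityʳ _))

    fibreSize-pos : ∀ t → 1 ≤ fibreSize t
    fibreSize-pos t with u , refl ← f-onto t =
      subst (_≤ fibreSize (f u)) (kronecker-refl (f u)) (term≤∑ _ u)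

    marked⇒fibreSize≥2 : ∀ t → 0 < markedIn t → 2 ≤ fibreSize t
    marked⇒fibreSize≥2 t pos with ∑-pos⇒pos _ pos
    ... | u , term-pos with kronecker*-pos (f u) t _ term-pos
    ... | refl , marked-u with partner u (𝟙-pos marked-u)
    ... | j , j≢u , fj≡fu = subst (_≤ fibreSize (f u))
      (cong₂ _+_ (kronecker-refl (f u))
                 (trans (cong (λ v → kronecker v (f u)) fj≡fu) (kronecker-refl (f u))))
      (two-terms≤∑ _ (j≢u ∘ sym))

    fibre-bound : ∀ t → markedIn t + 2 ≤ 2 * fibreSize t
    fibre-bound t with markedIn t | markedIn≤fibreSize t | marked⇒fibreSize≥2 t
    ... | zero  | _   | _        = *-monoʳ-≤ 2 (fibreSize-pos t)
    ... | suc _ | m≤s | two≤size = ≤-trans (+-mono-≤ m≤s (two≤size z<s))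
      (≤-reflexive (cong (fibreSize t +_) (sym (+-identityʳ (fibreSize t)))))

    ∑-fibreSize : ∑[ t < c ] fibreSize t ≡ k
    ∑-fibreSize = begin
      ∑[ t < c ] fibreSize t
        ≡⟨ sum-cong-≗ (λ t → sum-cong-≗ (λ i → *-identityʳ (kronecker (f i) t))) ⟨
      ∑[ t < c ] ∑[ i < k ] (kronecker (f i) t * 1)
        ≡⟨ ∑-fibres f (λ _ → 1) ⟨
      ∑[ i < k ] 1
        ≡⟨ ∑-const k 1 ⟩
      k * 1
        ≡⟨ *-identityʳ k ⟩
      k ∎
      where open ≡-Reasoning

  marked≤2*[k∸c] : ∑[ i < k ] 𝟙 (marked i) ≤ 2 * (k ∸ c)
  marked≤2*[k∸c] = begin
    ∑[ i < k ] 𝟙 (marked i)   ≤⟨ m+n≤o⇒m≤o∸n _ marked+2*c≤2*k ⟩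
    2 * k ∸ 2 * c             ≡⟨ *-distribˡ-∸ 2 k c ⟨
    2 * (k ∸ c)               ∎
    where
    open ≤-Reasoning
    marked+2*c≤2*k : ∑[ i < k ] 𝟙 (marked i) + 2 * c ≤ 2 * k
    marked+2*c≤2*k = begin
      ∑[ i < k ] 𝟙 (marked i) + 2 * c         ≡⟨ cong₂ _+_ (∑-fibres f (𝟙 ∘ marked)) (*-comm 2 c) ⟩
      ∑[ t < c ] markedIn t + c * 2           ≡⟨ cong (sum markedIn +_) (∑-const c 2) ⟨
      ∑[ t < c ] markedIn t + ∑[ t < c ] 2    ≡⟨ ∑-distrib-+ markedIn (λ _ → 2) ⟨
      ∑[ t < c ] (markedIn t + 2)             ≤⟨ ∑-mono-≤ fibre-bound ⟩
      ∑[ t < c ] (2 * fibreSize t)            ≡⟨ *-distribˡ-sum 2 fibreSize ⟨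
      2 * ∑[ t < c ] fibreSize t              ≡⟨ cong (2 *_) ∑-fibreSize ⟩
      2 * k                                   ∎

does⇒witness : ∀ {A : Set} (a? : Dec A) → does a? ≡ true → A
does⇒witness (yes a) _ = a

partOf : ∀ {n} (P : Partition n) → Fin (k P) → Subset n
partOf P u = Vec.tabulate (λ v → does (part P v ≟ u))

∈-partOf⁺ : ∀ {n} (P : Partition n) {v u} → part P v ≡ u → v ∈ partOf P u
∈-partOf⁺ P {v} {u} pv≡u =
  lookup⇒[]= v (partOf P u) (trans (lookup∘tabulate _ v) (dec-true (part P v ≟ u) pv≡u))

∈-partOf⁻ : ∀ {n} (P : Partition n) {v u} → v ∈ partOf P u → part P v ≡ u
∈-partOf⁻ P {v} {u} v∈u =
  does⇒witness (part P v ≟ u) (trans (sym (lookup∘tabulate _ v)) ([]=⇒lookup v∈u))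

partOf-nonemptyProper : ∀ {n} (P : Partition n) → 2 ≤ k P → ∀ u → NonemptyProper (partOf P u)
partOf-nonemptyProper P@record { k = suc (suc _) } (s≤s (s≤s z≤n)) u
  with v , pv≡u ← onto P u
  with w , pw≡u′ ← onto P (punchIn u zero)
  = (v , ∈-partOf⁺ P pv≡u)
  , (w , x∉p⇒x∈∁p (punchInᵢ≢i u zero ∘ trans (sym pw≡u′) ∘ ∈-partOf⁻ P))

anyB⇒∃ : ∀ {A : Set} (p : A → Bool) xs → anyB p xs ≡ true →
         ∃ λ x → x List.∈ xs × p x ≡ true
anyB⇒∃ p (x ∷ xs) any with p x in px
... | true  = x , here refl , px
... | false = let y , y∈xs , py = anyB⇒∃ p xs any in y , there y∈xs , py

crosses⇒ : ∀ {n} (S h : Subset n) → crosses S h ≡ true →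
           Nonempty (h ∩ S) × Nonempty (h ∩ ∁ S)
crosses⇒ S h cr with nonempty? (h ∩ S) | nonempty? (h ∩ ∁ S)
... | yes inside | yes outside = inside , outside

crossed-part-has-neighbour : ∀ {n} (G : Hedgegraph n) (P : Partition n) e u →
  inδ G (partOf P u) e ≡ true → ∃ λ j → j ≢ u × Adjacent G P e u j
crossed-part-has-neighbour G P e u e∈δ
  with h , h∈e , cr ← anyB⇒∃ (crosses (partOf P u)) (hedge G e) e∈δ
  with (x , x∈h∩S) , (y , y∈h∖S) ← crosses⇒ (partOf P u) h cr
  = part P y
  , (λ py≡u → x∈∁p⇒x∉p (proj₂ (x∈p∩q⁻ h _ y∈h∖S)) (∈-partOf⁺ P py≡u))
  , h , h∈e , x , y , proj₁ (x∈p∩q⁻ h _ x∈h∩S) , proj₁ (x∈p∩q⁻ h _ y∈h∖S)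
  , ∈-partOf⁻ P (proj₂ (x∈p∩q⁻ h _ x∈h∩S)) , refl

crossed-parts≤2*[k∸comps] : ∀ {n} (G : Hedgegraph n) (P : Partition n) e c →
  NumComps G P e c →
  ∑[ u < k P ] 𝟙 (inδ G (partOf P u) e) ≤ 2 * (k P ∸ c)
crossed-parts≤2*[k∸comps] G P e c (comp , comp-onto , comp⇔connected) =
  marked≤2*[k∸c] comp comp-onto (λ u → inδ G (partOf P u) e) same-component
  where
  same-component : ∀ u → inδ G (partOf P u) e ≡ true → ∃ λ j → j ≢ u × comp j ≡ comp u
  same-component u e∈δ =
    let j , j≢u , adj = crossed-part-has-neighbour G P e u e∈δ
    in j , j≢u , sym (Equivalence.from (comp⇔connected u j) (adj ◅ ε))

parts×connectivity≤2*∑[k∸comps] : ∀ {n} (G : Hedgegraph n) (P : Partition n)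
  (cs : Fin (m G) → ℕ) →
  (∀ e → NumComps G P e (cs e)) → 2 ≤ k P →
  ∀ l → (∀ S → NonemptyProper S → l ≤ cutSize G S) →
  k P * l ≤ 2 * ∑[ e < m G ] (k P ∸ cs e)
parts×connectivity≤2*∑[k∸comps] G P cs comps 2≤k l l≤cut = begin
  k P * l
    ≡⟨ ∑-const (k P) l ⟨
  ∑[ u < k P ] l
    ≤⟨ ∑-mono-≤ (λ u → l≤cut _ (partOf-nonemptyProper P 2≤k u)) ⟩
  ∑[ u < k P ] cutSize G (partOf P u)
    ≡⟨ sum-cong-≗ (λ u → sum-tabulate (crossedBy u)) ⟩
  ∑[ u < k P ] ∑[ e < m G ] crossedBy u e
    ≡⟨ ∑-comm crossedBy ⟩
  ∑[ e < m G ] ∑[ u < k P ] crossedBy u e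
    ≤⟨ ∑-mono-≤ (λ e → crossed-parts≤2*[k∸comps] G P e (cs e) (comps e)) ⟩
  ∑[ e < m G ] (2 * (k P ∸ cs e))
    ≡⟨ *-distribˡ-sum 2 (λ e → k P ∸ cs e) ⟨
  2 * ∑[ e < m G ] (k P ∸ cs e) ∎
  where
  open ≤-Reasoning
  crossedBy : Fin (k P) → Fin (m G) → ℕ
  crossedBy u e = 𝟙 (inδ G (partOf P u) e)

half≤quotient : ∀ d a s → (2 + d) * a ≤ 2 * s → a / 2 ≤ s / suc d
half≤quotient d a s le = begin
  a / 2                  ≡⟨ m*n/n≡m (a / 2) (suc d) ⟨
  a / 2 * suc d / suc d  ≤⟨ /-monoˡ-≤ {m = a / 2 * suc d} {n = s} (suc d)
                                      (*-cancelˡ-≤ 2 doubled) ⟩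
  s / suc d              ∎
  where
  open ≤-Reasoning
  doubled : 2 * (a / 2 * suc d) ≤ 2 * s
  doubled = begin
    2 * (a / 2 * suc d)  ≡⟨ *-assoc 2 (a / 2) (suc d) ⟨
    2 * (a / 2) * suc d  ≡⟨ cong (_* suc d) (*-comm 2 (a / 2)) ⟩
    a / 2 * 2 * suc d    ≤⟨ *-monoˡ-≤ (suc d) (m/n*n≤m a 2) ⟩
    a * suc d            ≤⟨ *-monoʳ-≤ a (n≤1+n (suc d)) ⟩
    a * (2 + d)          ≡⟨ *-comm a (2 + d) ⟩
    (2 + d) * a          ≤⟨ le ⟩
    2 * s                ∎

half-connectivity≤value : ∀ {n} (G : Hedgegraph n) (P : Partition n) l w →
  IsConnectivity G l → PartitionValue G P w → half∞ l ≤∞ w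
half-connectivity≤value G record { k = zero }      l _ _ (_ , _ , refl) = half∞ l ≤∞∞
half-connectivity≤value G record { k = suc zero }  l _ _ (_ , _ , refl) = half∞ l ≤∞∞
half-connectivity≤value G P@record { k = suc (suc _) } ∞ _ no-cut _ =
  contradiction (partOf-nonemptyProper P (s≤s (s≤s z≤n)) zero) (no-cut (partOf P zero))
half-connectivity≤value G P@record { k = suc (suc d) } (fin a) _ (_ , a≤cut) (cs , comps , refl) =
  fin≤fin (subst (λ s → a / 2 ≤ s / suc d) (sym (sum-tabulate (λ e → suc (suc d) ∸ cs e)))
    (half≤quotient d a (∑[ e < m G ] (suc (suc d) ∸ cs e))
      (parts×connectivity≤2*∑[k∸comps] G P cs comps (s≤s (s≤s z≤n)) a a≤cut)))

lemma4p1 : ∀ {n : ℕ} (G : Hedgegraph n) (l w : ℕ∞) →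
             IsConnectivity G l → IsWPC G w → half∞ l ≤∞ w
lemma4p1 G l w connectivity ((P , value) , _) = half-connectivity≤value G P l w connectivity value
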